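{- Let $\mathcal{R}$ be a TRS and $l\to r$ a rewrite rule (i.e. $l\notin\mathcal{V}$ and $\mathcal{V}(r)\subseteq\mathcal{V}(l)$) such that $l\stackrel{*}{\leftrightarrow}_{\mathcal{R}}r$ and $l\notin\mathrm{NF}(\mathcal{R})$. Then $\mathcal{R}$ has UNC if and only if $\mathcal{R}\cup\{l\to r\}$ has UNC.
   Context: A TRS is a finite set of rewrite rules over terms $\mathrm{T}(\mathcal{F},\mathcal{V})$; $\to_{\mathcal{R}}$ is its rewrite relation, $\stackrel{*}{\leftrightarrow}_{\mathcal{R}}$ the equivalence closure, $\mathrm{NF}(\mathcal{R})$ the set of normal forms. A TRS has UNC if any two convertible normal forms are identical. -}

module Defs where

open import Data.Nat using (ℕ)
open import Data.Fin using (Fin)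
open import Data.Vec using (Vec; []; _∷_; lookup; _[_]≔_)
open import Data.List using (List; _∷_)
open import Data.List.Membership.Propositional using (_∈_)
open import Data.Product using (∃)
open import Relation.Nullary using (¬_)
open import Relation.Binary.PropositionalEquality using (_≡_; _≢_)
open import Relation.Binary.Construct.Closure.Equivalence using (EqClosure)

record Signature : Set₁ where
  field
    Sym   : Set
    arity : Sym → ℕ
open Signature public

Var : Set
Var = ℕ

module _ (Σ : Signature) where

  data Term : Set where
    var : Var → Term
    fun : (f : Sym Σ) → Vec Term (arity Σ f) → Term

  data _occursIn_ (x : Var) : Term → Set where
    here : x occursIn var x
    arg  : ∀ {f ts} (i : Fin (arity Σ f)) → x occursIn lookup ts i → x occursIn fun f ts

  Subst : Set
  Subst = Var → Term

  mutual
    _⟨_⟩ : Term → Subst → Term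
    var x    ⟨ σ ⟩ = σ x
    fun f ts ⟨ σ ⟩ = fun f (substs ts σ)

    substs : ∀ {n} → Vec Term n → Subst → Vec Term n
    substs []       σ = []
    substs (t ∷ ts) σ = (t ⟨ σ ⟩) ∷ substs ts σ

  record Rule : Set where
    constructor rule
    field
      lhs : Term
      rhs : Term
      lhs-nonvar : ∀ x → lhs ≢ var x
      rhs-vars   : ∀ x → x occursIn rhs → x occursIn lhs
  open Rule public

  TRS : Set
  TRS = List Rule

  data _⊢_⟶_ (R : TRS) : Term → Term → Set where
    root : ∀ {ρ} → ρ ∈ R → (σ : Subst) → R ⊢ (lhs ρ ⟨ σ ⟩) ⟶ (rhs ρ ⟨ σ ⟩)
    ctx  : ∀ {f ts u} (i : Fin (arity Σ f)) → R ⊢ lookup ts i ⟶ u →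
           R ⊢ fun f ts ⟶ fun f (ts [ i ]≔ u)

  _⊢_↔*_ : TRS → Term → Term → Set
  R ⊢ s ↔* t = EqClosure (R ⊢_⟶_) s t

  NF : TRS → Term → Set
  NF R t = ¬ ∃ (λ u → R ⊢ t ⟶ u)

  UNC : TRS → Set
  UNC R = ∀ s t → NF R s → NF R t → R ⊢ s ↔* t → s ≡ t

-- Every ρ-step is an instance of the R-conversion l ↔* r placed in a context,
-- so ↔*_{R ∪ {ρ}} = ↔*_R; and since l is R-reducible, so is every instance
-- of l, so NF(R ∪ {ρ}) = NF(R).  UNC mentions only conversion and normal
-- forms, hence holds for both systems or for neither.
module Submission where

open import Defs
open import Data.Fin using (zero; suc)
open import Data.List using (_∷_)
open import Data.List.Membership.Propositional using (_∈_)
open import Data.List.Relation.Binary.Subset.Propositional using (_⊆_)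
open import Data.List.Relation.Unary.Any using (here; there)
open import Data.Product using (_,_)
open import Data.Vec using (Vec; []; _∷_; lookup; _[_]≔_)
open import Data.Vec.Properties using ([]≔-idempotent; []≔-lookup; lookup∘update)
open import Function.Bundles using (_⇔_; mk⇔)
open import Relation.Binary.PropositionalEquality
open import Relation.Nullary using (¬_)
import Relation.Binary.Construct.Closure.Equivalence as EqClosure

module _ (Σ : Signature) where

  private variable
    R R′ : TRS Σ
    ρ : Rule Σ
    s t : Term Σ
    σ τ : Subst Σ

  _∘ₛ_ : Subst Σ → Subst Σ → Subst Σ
  (τ ∘ₛ σ) x = _⟨_⟩ Σ (τ x) σ

  mutual
    ⟨⟩-∘ₛ : (t : Term Σ) → _⟨_⟩ Σ (_⟨_⟩ Σ t τ) σ ≡ _⟨_⟩ Σ t (τ ∘ₛ σ)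
    ⟨⟩-∘ₛ (var x)    = refl
    ⟨⟩-∘ₛ (fun f ts) = cong (fun f) (substs-∘ₛ ts)

    substs-∘ₛ : ∀ {n} (ts : Vec (Term Σ) n) → substs Σ (substs Σ ts τ) σ ≡ substs Σ ts (τ ∘ₛ σ)
    substs-∘ₛ []       = refl
    substs-∘ₛ (t ∷ ts) = cong₂ _∷_ (⟨⟩-∘ₛ t) (substs-∘ₛ ts)

  mutual
    ⟨var⟩ : (t : Term Σ) → _⟨_⟩ Σ t var ≡ t
    ⟨var⟩ (var x)    = refl
    ⟨var⟩ (fun f ts) = cong (fun f) (substs-var ts)

    substs-var : ∀ {n} (ts : Vec (Term Σ) n) → substs Σ ts var ≡ ts
    substs-var []       = refl
    substs-var (t ∷ ts) = cong₂ _∷_ (⟨var⟩ t) (substs-var ts)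

  lookup-substs : ∀ {n} (ts : Vec (Term Σ) n) i →
                  lookup (substs Σ ts σ) i ≡ _⟨_⟩ Σ (lookup ts i) σ
  lookup-substs (t ∷ ts) zero    = refl
  lookup-substs (t ∷ ts) (suc i) = lookup-substs ts i

  substs-[]≔ : ∀ {n} (ts : Vec (Term Σ) n) i u →
               substs Σ (ts [ i ]≔ u) σ ≡ substs Σ ts σ [ i ]≔ _⟨_⟩ Σ u σ
  substs-[]≔ (t ∷ ts) zero    u = refl
  substs-[]≔ (t ∷ ts) (suc i) u = cong (_ ∷_) (substs-[]≔ ts i u)

  ⟶-rule : ρ ∈ R → _⊢_⟶_ Σ R (lhs ρ) (rhs ρ)
  ⟶-rule {ρ} {R} ρ∈R =
    subst₂ (_⊢_⟶_ Σ R) (⟨var⟩ (lhs ρ)) (⟨var⟩ (rhs ρ)) (root ρ∈R var)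

  ⟶-⟨⟩ : ∀ σ → _⊢_⟶_ Σ R s t → _⊢_⟶_ Σ R (_⟨_⟩ Σ s σ) (_⟨_⟩ Σ t σ)
  ⟶-⟨⟩ {R} σ (root {ρ} ρ∈R τ) =
    subst₂ (_⊢_⟶_ Σ R) (sym (⟨⟩-∘ₛ (lhs ρ))) (sym (⟨⟩-∘ₛ (rhs ρ))) (root ρ∈R (τ ∘ₛ σ))
  ⟶-⟨⟩ {R} σ (ctx {f} {ts} {u} i step) =
    subst (λ vs → _⊢_⟶_ Σ R (fun f (substs Σ ts σ)) (fun f vs)) (sym (substs-[]≔ ts i u))
      (ctx i (subst (λ w → _⊢_⟶_ Σ R w _) (sym (lookup-substs ts i)) (⟶-⟨⟩ σ step)))

  ↔*-⟨⟩ : ∀ σ → _⊢_↔*_ Σ R s t → _⊢_↔*_ Σ R (_⟨_⟩ Σ s σ) (_⟨_⟩ Σ t σ)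
  ↔*-⟨⟩ σ = EqClosure.gmap (λ s → _⟨_⟩ Σ s σ) (⟶-⟨⟩ σ)

  ⟶-[]≔ : ∀ {f} (ts : Vec (Term Σ) (arity Σ f)) i → _⊢_⟶_ Σ R s t →
          _⊢_⟶_ Σ R (fun f (ts [ i ]≔ s)) (fun f (ts [ i ]≔ t))
  ⟶-[]≔ {R} {s} {t} {f} ts i step =
    subst (λ vs → _⊢_⟶_ Σ R (fun f (ts [ i ]≔ s)) (fun f vs)) ([]≔-idempotent ts i)
      (ctx i (subst (λ w → _⊢_⟶_ Σ R w t) (sym (lookup∘update i ts s)) step))

  ↔*-[]≔ : ∀ {f} (ts : Vec (Term Σ) (arity Σ f)) i → _⊢_↔*_ Σ R s t →
           _⊢_↔*_ Σ R (fun f (ts [ i ]≔ s)) (fun f (ts [ i ]≔ t))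
  ↔*-[]≔ {f = f} ts i = EqClosure.gmap (λ s → fun f (ts [ i ]≔ s)) (⟶-[]≔ ts i)

  ⟶-mono : R ⊆ R′ → _⊢_⟶_ Σ R s t → _⊢_⟶_ Σ R′ s t
  ⟶-mono R⊆R′ (root ρ∈R σ) = root (R⊆R′ ρ∈R) σ
  ⟶-mono R⊆R′ (ctx i step)  = ctx i (⟶-mono R⊆R′ step)

  ↔*-mono : R ⊆ R′ → _⊢_↔*_ Σ R s t → _⊢_↔*_ Σ R′ s t
  ↔*-mono R⊆R′ = EqClosure.map (⟶-mono R⊆R′)

  NF-antimono : R ⊆ R′ → NF Σ R′ t → NF Σ R t
  NF-antimono R⊆R′ nf (u , step) = nf (u , ⟶-mono R⊆R′ step)

  -- ↔*_R is closed under substitution and contexts.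
  ↔*-of-convertible-rules : (∀ {ρ} → ρ ∈ R′ → _⊢_↔*_ Σ R (lhs ρ) (rhs ρ)) →
                            _⊢_↔*_ Σ R′ s t → _⊢_↔*_ Σ R s t
  ↔*-of-convertible-rules {R′} {R} convertible =
    EqClosure.fold (EqClosure.isEquivalence (_⊢_⟶_ Σ R)) ⟶⇒↔*
    where
    ⟶⇒↔* : _⊢_⟶_ Σ R′ s t → _⊢_↔*_ Σ R s t
    ⟶⇒↔* (root ρ∈R′ σ) = ↔*-⟨⟩ σ (convertible ρ∈R′)
    ⟶⇒↔* (ctx {f} {ts} {u} i step) =
      subst (λ vs → _⊢_↔*_ Σ R (fun f vs) (fun f (ts [ i ]≔ u))) ([]≔-lookup ts i)
        (↔*-[]≔ ts i (⟶⇒↔* step))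

  NF-of-reducible-lhss : (∀ {ρ} → ρ ∈ R′ → ¬ NF Σ R (lhs ρ)) → NF Σ R t → NF Σ R′ t
  NF-of-reducible-lhss {R′} {R} reducible nf (_ , step) = irreducible step nf
    where
    irreducible : _⊢_⟶_ Σ R′ s t → ¬ NF Σ R s
    irreducible (root ρ∈R′ σ) nf =
      reducible ρ∈R′ (λ { (_ , step) → nf (_ , ⟶-⟨⟩ σ step) })
    irreducible (ctx i step)  nf =
      irreducible step (λ { (_ , step′) → nf (_ , ctx i step′) })

  UNC-transfer : (∀ {t} → NF Σ R′ t → NF Σ R t) →
                 (∀ {s t} → _⊢_↔*_ Σ R′ s t → _⊢_↔*_ Σ R s t) →
                 UNC Σ R → UNC Σ R′
  UNC-transfer NF⊆ ↔*⊆ unc s t nfs nft s↔*t = unc s t (NF⊆ nfs) (NF⊆ nft) (↔*⊆ s↔*t)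

lemma2 : (Σ : Signature) (R : TRS Σ) (ρ : Rule Σ) →
         _⊢_↔*_ Σ R (lhs ρ) (rhs ρ) →
         ¬ NF Σ R (lhs ρ) →
         UNC Σ R ⇔ UNC Σ (ρ ∷ R)
lemma2 Σ R ρ l↔*r l-reducible = mk⇔
  (UNC-transfer Σ (NF-antimono Σ there) (↔*-of-convertible-rules Σ convertible))
  (UNC-transfer Σ (NF-of-reducible-lhss Σ reducible) (↔*-mono Σ there))
  where
  convertible : ∀ {π} → π ∈ ρ ∷ R → _⊢_↔*_ Σ R (lhs π) (rhs π)
  convertible (here refl)  = l↔*r
  convertible (there π∈R) = EqClosure.return (⟶-rule Σ π∈R)

  reducible : ∀ {π} → π ∈ ρ ∷ R → ¬ NF Σ R (lhs π)
  reducible (here refl)  = l-reducible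
  reducible (there π∈R) nf = nf (_ , ⟶-rule Σ π∈R)
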